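{- Let $s,t$ be real numbers with $s\neq0$, $t\neq0$, and let $q=\varphi'_{s,t}/\varphi_{s,t}$. Then \[ \sum_{n=1}^{\infty}\genfrac{\{}{\}}{0pt}{}{n+1}{2}_{s,t}^2x^n=\frac{x+(\{4\}_{s,t}\varphi_{s,t}-\varphi_{s,t}^4)x^2-\{3\}_{s,t}\varphi_{s,t}^3\varphi_{s,t}^{\prime3}x^3+(\{3\}_{s,t}\varphi_{s,t}^7\varphi_{s,t}^{\prime3}-\{4\}_{s,t}\varphi_{s,t}^6\varphi_{s,t}^{\prime3})x^4}{(1-t^2x)(1-\varphi_{s,t}^{\prime4}x)(\varphi_{s,t}^4x;q)_{4}}. \]
   Context: The generalized Fibonacci polynomials $\{n\}_{s,t}$ are defined by $\{0\}_{s,t}=0$, $\{1\}_{s,t}=1$, $\{n+2\}_{s,t}=s\{n+1\}_{s,t}+t\{n\}_{s,t}$. Set $\varphi_{s,t}=\frac{s+\sqrt{s^2+4t}}{2}$, $\varphi'_{s,t}=\frac{s-\sqrt{s^2+4t}}{2}$. The generalized triangular numbers are $\genfrac{\{}{\}}{0pt}{}{n+1}{2}_{s,t}=\frac{\{n\}_{s,t}\{n+1\}_{s,t}}{\{2\}_{s,t}}$. The $q$-Pochhammer symbol is $(a;q)_m=\prod_{k=0}^{m-1}(1-aq^k)$, so $(\varphi_{s,t}^4x;q)_4=\prod_{k=0}^{3}(1-\varphi_{s,t}^{4-k}\varphi_{s,t}^{\prime k}x)$. The identity is between formal power series in $x$. -}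

module Defs where

open import Level using (Level)
open import Data.Nat using (ℕ; zero; suc; _∸_)
open import Algebra.Bundles using (CommutativeRing)

-- Everything is developed over an arbitrary commutative ring R
-- (the paper works over ℝ / ℂ, which are instances).
module Gen {c ℓ : Level} (R : CommutativeRing c ℓ) where
  open CommutativeRing R renaming (Carrier to C) hiding (zero)

  pow : C → ℕ → C
  pow a zero    = 1#
  pow a (suc n) = a * pow a n

  fib : C → C → ℕ → C
  fib s t zero          = 0#
  fib s t (suc zero)    = 1#
  fib s t (suc (suc n)) = s * fib s t (suc n) + t * fib s t n

  -- generalized triangular number {n+1 choose 2}_{s,t} = {n}{n+1}/{2},
  -- where division by {2}_{s,t} = s is multiplication by a given inverse sinv of s
  tri : C → C → C → ℕ → C
  tri s t sinv n = fib s t n * fib s t (suc n) * sinv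

  sumTo : ℕ → (ℕ → C) → C
  sumTo zero    h = h zero
  sumTo (suc n) h = sumTo n h + h (suc n)

  Series : Set c
  Series = ℕ → C

  _⊛_ : Series → Series → Series
  (f ⊛ g) n = sumTo n (λ k → f k * g (n ∸ k))

  lin : C → Series
  lin a zero             = 1#
  lin a (suc zero)       = - a
  lin a (suc (suc n))    = 0#

  -- (φ^4 x; q)_4 = ∏_{k=0}^{3} (1 - φ^{4-k} φ'^k x)   (q = φ'/φ)
  poch4 : C → C → Series
  poch4 φ φ' = lin (pow φ 4) ⊛ (lin (pow φ 3 * φ') ⊛ (lin (pow φ 2 * pow φ' 2) ⊛ lin (φ * pow φ' 3)))

  denom : C → C → C → Series
  denom t φ φ' = lin (pow t 2) ⊛ (lin (pow φ' 4) ⊛ poch4 φ φ')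

  numer : C → C → C → C → Series
  numer s t φ φ' zero                            = 0#
  numer s t φ φ' (suc zero)                      = 1#
  numer s t φ φ' (suc (suc zero))                = fib s t 4 * φ - pow φ 4
  numer s t φ φ' (suc (suc (suc zero)))          = - (fib s t 3 * pow φ 3 * pow φ' 3)
  numer s t φ φ' (suc (suc (suc (suc zero))))    =
    fib s t 3 * pow φ 7 * pow φ' 3 - fib s t 4 * pow φ 6 * pow φ' 3
  numer s t φ φ' (suc (suc (suc (suc (suc n))))) = 0#

  triSq : C → C → C → Series
  triSq s t sinv zero    = 0#
  triSq s t sinv (suc n) = pow (tri s t sinv (suc n)) 2

{-# OPTIONS --safe #-}
module Submission where

open import Defs
open import Level using (Level; 0ℓ; _⊔_)
open import Data.Nat using (ℕ)
open import Relation.Nullary using (¬_)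
open import Algebra.Bundles using (CommutativeRing)

open import Data.Nat as ℕ using (zero; suc; _∸_; _≤_; _<_; z≤n; s≤s; _<?_)
import Data.Nat.Properties as ℕ
open import Data.Integer as ℤ using (ℤ; +_; -[1+_]; _⊖_)
import Data.Integer.Properties as ℤ
open import Data.Sign as Sign using (Sign)
open import Data.Fin using (#_)
open import Data.Maybe using (just; nothing)
open import Data.Vec using (Vec; []; _∷_)
open import Relation.Nullary using (yes; no)
import Relation.Binary.PropositionalEquality as ≡
open import Relation.Binary.Definitions using (WeaklyDecidable)
open import Algebra.Bundles using (RawRing)
open import Algebra.Morphism.Structures using (IsRingMonomorphism)
import Algebra.Morphism.RingMonomorphism as RingMonomorphism
import Algebra.Construct.Pointwise as Pointwise
open import Algebra.Solver.Ring.AlmostCommutativeRing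
  using (fromCommutativeRing; _-Raw-AlmostCommutative⟶_)
import Algebra.Solver.Ring as Solver

-- Every solution of a_{n+2} = s a_{n+1} + t a_n is a combination of φⁿ and
-- φ'ⁿ, so for two solutions a and b the sequence (a_n b_n)² is a combination of
-- φ^{4n}, φ^{3n}φ'ⁿ, (φφ')^{2n}, φⁿφ'^{3n} and φ'^{4n}, and is annihilated by the
-- denominator D.  Avoiding Binet's formula (and its division by φ − φ'), this is
-- the single identity Σ_{k≤6} D_k (a_{6−k} b_{6−k})² = 0, polynomial in φ, φ' and
-- the initial values; applied to shifts of a_n = {n} and b_n = {n+1} it shows that
-- D times the series has no terms of degree ≥ 6.  The six remaining coefficients
-- are polynomial identities too.  All of them are proved by normalising integer
-- polynomial expressions.

module IntegerCoefficients {c ℓ : Level} (R : CommutativeRing c ℓ) where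
  open CommutativeRing R
  open import Algebra.Properties.Ring ring
    using (-‿involutive; -0#≈0#; -‿distribˡ-*; -‿distribʳ-*)
  open import Algebra.Properties.AbelianGroup +-abelianGroup using (⁻¹-∙-comm)
  open import Algebra.Properties.CommutativeSemigroup +-commutativeSemigroup
    using (interchange)
  open import Algebra.Properties.Semiring.Mult.TCOptimised semiring
    using (_×_; 1+×; ×-homo-+; ×1-homo-*)
  open import Relation.Binary.Reasoning.Setoid setoid

  fromℤ : ℤ → Carrier
  fromℤ (+ n)    = n × 1#
  fromℤ -[1+ n ] = - (suc n × 1#)

  [1+x]-[1+y]≈x-y : ∀ x y → (1# + x) - (1# + y) ≈ x - y
  [1+x]-[1+y]≈x-y x y = begin
    (1# + x) - (1# + y)       ≈⟨ +-congˡ (⁻¹-∙-comm 1# y) ⟨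
    (1# + x) + (- 1# + - y)   ≈⟨ interchange 1# x (- 1#) (- y) ⟩
    (1# - 1#) + (x - y)       ≈⟨ +-congʳ (-‿inverseʳ 1#) ⟩
    0# + (x - y)              ≈⟨ +-identityˡ (x - y) ⟩
    x - y                     ∎

  fromℤ-⊖ : ∀ m n → fromℤ (m ⊖ n) ≈ m × 1# - n × 1#
  fromℤ-⊖ zero    zero    = sym (trans (+-congˡ -0#≈0#) (+-identityʳ 0#))
  fromℤ-⊖ (suc m) zero    = sym (trans (+-congˡ -0#≈0#) (+-identityʳ _))
  fromℤ-⊖ zero    (suc n) = sym (+-identityˡ _)
  fromℤ-⊖ (suc m) (suc n) = begin
    fromℤ (suc m ⊖ suc n)           ≡⟨ ≡.cong fromℤ (ℤ.[1+m]⊖[1+n]≡m⊖n m n) ⟩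
    fromℤ (m ⊖ n)                   ≈⟨ fromℤ-⊖ m n ⟩
    m × 1# - n × 1#                 ≈⟨ [1+x]-[1+y]≈x-y (m × 1#) (n × 1#) ⟨
    (1# + m × 1#) - (1# + n × 1#)   ≈⟨ +-cong (1+× m 1#) (-‿cong (1+× n 1#)) ⟨
    suc m × 1# - suc n × 1#         ∎

  fromℤ-+ : ∀ i j → fromℤ (i ℤ.+ j) ≈ fromℤ i + fromℤ j
  fromℤ-+ (+ m)    (+ n)    = ×-homo-+ 1# m n
  fromℤ-+ (+ m)    -[1+ n ] = fromℤ-⊖ m (suc n)
  fromℤ-+ -[1+ m ] (+ n)    = trans (fromℤ-⊖ n (suc m)) (+-comm _ _)
  fromℤ-+ -[1+ m ] -[1+ n ] = begin
    - (suc (suc (m ℕ.+ n)) × 1#)      ≡⟨ ≡.cong (λ k → - (suc k × 1#)) (≡.sym (ℕ.+-suc m n)) ⟩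
    - ((suc m ℕ.+ suc n) × 1#)        ≈⟨ -‿cong (×-homo-+ 1# (suc m) (suc n)) ⟩
    - (suc m × 1# + suc n × 1#)       ≈⟨ ⁻¹-∙-comm _ _ ⟨
    - (suc m × 1#) + - (suc n × 1#)   ∎

  signed : Sign → Carrier → Carrier
  signed Sign.+ x = x
  signed Sign.- x = - x

  signed-cong : ∀ σ {x y} → x ≈ y → signed σ x ≈ signed σ y
  signed-cong Sign.+ x≈y = x≈y
  signed-cong Sign.- x≈y = -‿cong x≈y

  signed-* : ∀ σ τ x y → signed (σ Sign.* τ) (x * y) ≈ signed σ x * signed τ y
  signed-* Sign.+ Sign.+ x y = refl
  signed-* Sign.+ Sign.- x y = -‿distribʳ-* x y
  signed-* Sign.- Sign.+ x y = -‿distribˡ-* x y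
  signed-* Sign.- Sign.- x y = begin
    x * y         ≈⟨ -‿involutive (x * y) ⟨
    - - (x * y)   ≈⟨ -‿cong (-‿distribʳ-* x y) ⟩
    - (x * - y)   ≈⟨ -‿distribˡ-* x (- y) ⟩
    - x * - y     ∎

  fromℤ-◃ : ∀ σ n → fromℤ (σ ℤ.◃ n) ≈ signed σ (n × 1#)
  fromℤ-◃ Sign.+ zero    = refl
  fromℤ-◃ Sign.- zero    = sym -0#≈0#
  fromℤ-◃ Sign.+ (suc n) = refl
  fromℤ-◃ Sign.- (suc n) = refl

  fromℤ-signed : ∀ i → fromℤ i ≈ signed (ℤ.sign i) (ℤ.∣ i ∣ × 1#)
  fromℤ-signed (+ n)    = refl
  fromℤ-signed -[1+ n ] = refl

  fromℤ-* : ∀ i j → fromℤ (i ℤ.* j) ≈ fromℤ i * fromℤ j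
  fromℤ-* i j = begin
    fromℤ (σ Sign.* τ ℤ.◃ m ℕ.* n)          ≈⟨ fromℤ-◃ (σ Sign.* τ) (m ℕ.* n) ⟩
    signed (σ Sign.* τ) ((m ℕ.* n) × 1#)    ≈⟨ signed-cong (σ Sign.* τ) (×1-homo-* m n) ⟩
    signed (σ Sign.* τ) (m × 1# * n × 1#)   ≈⟨ signed-* σ τ (m × 1#) (n × 1#) ⟩
    signed σ (m × 1#) * signed τ (n × 1#)   ≈⟨ *-cong (fromℤ-signed i) (fromℤ-signed j) ⟨
    fromℤ i * fromℤ j                       ∎
    where σ = ℤ.sign i; τ = ℤ.sign j; m = ℤ.∣ i ∣; n = ℤ.∣ j ∣

  fromℤ-neg : ∀ i → fromℤ (ℤ.- i) ≈ - fromℤ i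
  fromℤ-neg (+ zero)  = sym -0#≈0#
  fromℤ-neg (+ suc n) = refl
  fromℤ-neg -[1+ n ]  = sym (-‿involutive _)

  fromℤ-morphism : ℤ.+-*-rawRing -Raw-AlmostCommutative⟶ fromCommutativeRing R
  fromℤ-morphism = record
    { ⟦_⟧    = fromℤ
    ; +-homo = fromℤ-+
    ; *-homo = fromℤ-*
    ; -‿homo = fromℤ-neg
    ; 0-homo = refl
    ; 1-homo = refl
    }

  fromℤ-≟ : WeaklyDecidable (λ i j → fromℤ i ≈ fromℤ j)
  fromℤ-≟ i j with i ℤ.≟ j
  ... | yes ≡.refl = just refl
  ... | no _       = nothing

  open Solver ℤ.+-*-rawRing (fromCommutativeRing R) fromℤ-morphism fromℤ-≟ public
    using (Polynomial; op; [+]; [*]; con; var; :-_; ⟦_⟧; ⟦_⟧↓; prove)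

  -- Integer polynomial expressions in n variables, identified when they agree
  -- at every point of Rⁿ.  Evaluating a definition of Defs instantiated at this
  -- ring gives, by computation, the same definition over R, so identities
  -- between such instances can be proved with `prove ρ e₁ e₂ refl` whenever
  -- e₁ and e₂ have the same normal form.
  module _ (n : ℕ) where
    private module Functions = Pointwise (Vec Carrier n)

    polynomialRawRing : RawRing 0ℓ (c ⊔ ℓ)
    polynomialRawRing = record
      { Carrier = Polynomial n
      ; _≈_     = λ p q → ∀ ρ → ⟦ p ⟧ ρ ≈ ⟦ q ⟧ ρ
      ; _+_     = op [+]
      ; _*_     = op [*]
      ; -_      = :-_
      ; 0#      = con ℤ.0ℤ
      ; 1#      = con ℤ.1ℤ
      }

    ⟦⟧-isRingMonomorphism : IsRingMonomorphism polynomialRawRing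
      (CommutativeRing.rawRing (Functions.commutativeRing R)) ⟦_⟧
    ⟦⟧-isRingMonomorphism = record
      { isRingHomomorphism = record
        { isSemiringHomomorphism = record
          { isNearSemiringHomomorphism = record
            { +-isMonoidHomomorphism = record
              { isMagmaHomomorphism = record
                { isRelHomomorphism = record { cong = λ p≈q → p≈q }
                ; homo              = λ _ _ _ → refl
                }
              ; ε-homo = λ _ → refl
              }
            ; *-homo = λ _ _ _ → refl
            }
          ; 1#-homo = λ _ → refl
          }
        ; -‿homo = λ _ _ → refl
        }
      ; injective = λ p≈q → p≈q
      }

    polynomialRing : CommutativeRing 0ℓ (c ⊔ ℓ)
    polynomialRing = record
      { isCommutativeRing = RingMonomorphism.isCommutativeRing ⟦⟧-isRingMonomorphism
          (CommutativeRing.isCommutativeRing (Functions.commutativeRing R))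
      }

module GenProperties {c ℓ : Level} (R : CommutativeRing c ℓ) where
  open CommutativeRing R renaming (Carrier to C) hiding (zero)
  open Gen R
  open import Relation.Binary.Reasoning.Setoid setoid

  pow-cong : ∀ {a b} → a ≈ b → ∀ n → pow a n ≈ pow b n
  pow-cong a≈b zero    = refl
  pow-cong a≈b (suc n) = *-cong a≈b (pow-cong a≈b n)

  fib-cong : ∀ {s s' t t'} → s ≈ s' → t ≈ t' → ∀ n → fib s t n ≈ fib s' t' n
  fib-cong s≈s' t≈t' zero          = refl
  fib-cong s≈s' t≈t' (suc zero)    = refl
  fib-cong s≈s' t≈t' (suc (suc n)) =
    +-cong (*-cong s≈s' (fib-cong s≈s' t≈t' (suc n))) (*-cong t≈t' (fib-cong s≈s' t≈t' n))

  lin-cong : ∀ {a b} → a ≈ b → ∀ k → lin a k ≈ lin b k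
  lin-cong a≈b zero          = refl
  lin-cong a≈b (suc zero)    = -‿cong a≈b
  lin-cong a≈b (suc (suc k)) = refl

  sumTo-cong : ∀ n {h h' : ℕ → C} → (∀ k → h k ≈ h' k) → sumTo n h ≈ sumTo n h'
  sumTo-cong zero    h≈h' = h≈h' zero
  sumTo-cong (suc n) h≈h' = +-cong (sumTo-cong n h≈h') (h≈h' (suc n))

  ⊛-cong : ∀ {f f' g g'} → (∀ k → f k ≈ f' k) → (∀ k → g k ≈ g' k) → ∀ n → (f ⊛ g) n ≈ (f' ⊛ g') n
  ⊛-cong f≈f' g≈g' n = sumTo-cong n (λ k → *-cong (f≈f' k) (g≈g' (n ∸ k)))

  denom-cong : ∀ {t t'} φ φ' → t ≈ t' → ∀ k → denom t φ φ' k ≈ denom t' φ φ' k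
  denom-cong φ φ' t≈t' = ⊛-cong {g = g} {g' = g} (lin-cong (pow-cong t≈t' 2)) (λ _ → refl)
    where
    g : Series
    g = lin (pow φ' 4) ⊛ poch4 φ φ'

  triSq-cong : ∀ {s s' t t'} sinv → s ≈ s' → t ≈ t' → ∀ n → triSq s t sinv n ≈ triSq s' t' sinv n
  triSq-cong sinv s≈s' t≈t' zero    = refl
  triSq-cong sinv s≈s' t≈t' (suc n) =
    pow-cong (*-congʳ (*-cong (fib-cong s≈s' t≈t' (suc n)) (fib-cong s≈s' t≈t' (suc (suc n))))) 2

  numer-cong : ∀ {s s' t t'} φ φ' → s ≈ s' → t ≈ t' → ∀ n → numer s t φ φ' n ≈ numer s' t' φ φ' n
  numer-cong φ φ' s≈s' t≈t' 0 = refl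
  numer-cong φ φ' s≈s' t≈t' 1 = refl
  numer-cong φ φ' s≈s' t≈t' 2 = +-congʳ (*-congʳ (fib-cong s≈s' t≈t' 4))
  numer-cong φ φ' s≈s' t≈t' 3 = -‿cong (*-congʳ (*-congʳ (fib-cong s≈s' t≈t' 3)))
  numer-cong φ φ' s≈s' t≈t' 4 =
    +-cong (*-congʳ (*-congʳ (fib-cong s≈s' t≈t' 3))) (-‿cong (*-congʳ (*-congʳ (fib-cong s≈s' t≈t' 4))))
  numer-cong φ φ' s≈s' t≈t' (suc (suc (suc (suc (suc n))))) = refl

  triSq≈tri² : ∀ s t sinv n → triSq s t sinv n ≈ pow (tri s t sinv n) 2
  triSq≈tri² s t sinv (suc n) = refl
  triSq≈tri² s t sinv zero    = sym (begin
    pow (0# * 1# * sinv) 2        ≈⟨ *-congʳ (trans (*-congʳ (zeroˡ 1#)) (zeroˡ sinv)) ⟩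
    0# * pow (0# * 1# * sinv) 1   ≈⟨ zeroˡ _ ⟩
    0#                            ∎)

  sumTo-zero : ∀ n {h : ℕ → C} → (∀ k → k ≤ n → h k ≈ 0#) → sumTo n h ≈ 0#
  sumTo-zero zero    h≈0 = h≈0 zero z≤n
  sumTo-zero (suc n) {h} h≈0 = begin
    sumTo n h + h (suc n)   ≈⟨ +-cong (sumTo-zero n (λ k k≤n → h≈0 k (ℕ.m≤n⇒m≤1+n k≤n))) (h≈0 (suc n) ℕ.≤-refl) ⟩
    0# + 0#                 ≈⟨ +-identityʳ 0# ⟩
    0#                      ∎

  sumTo-extend : ∀ d {h : ℕ → C} → (∀ k → d < k → h k ≈ 0#) → ∀ m → sumTo (d ℕ.+ m) h ≈ sumTo d h
  sumTo-extend d {h} h≈0 zero    = reflexive (≡.cong (λ n → sumTo n h) (ℕ.+-identityʳ d))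
  sumTo-extend d {h} h≈0 (suc m) = begin
    sumTo (d ℕ.+ suc m) h                   ≡⟨ ≡.cong (λ n → sumTo n h) (ℕ.+-suc d m) ⟩
    sumTo (d ℕ.+ m) h + h (suc (d ℕ.+ m))   ≈⟨ +-cong (sumTo-extend d h≈0 m) (h≈0 _ (s≤s (ℕ.m≤m+n d m))) ⟩
    sumTo d h + 0#                          ≈⟨ +-identityʳ _ ⟩
    sumTo d h                               ∎

  _HasDegree≤_ : Series → ℕ → Set ℓ
  f HasDegree≤ d = ∀ k → d < k → f k ≈ 0#

  lin-degree : ∀ a → lin a HasDegree≤ 1
  lin-degree a (suc (suc k)) _ = refl
  lin-degree a (suc zero) (s≤s ())

  ⊛-degree : ∀ {f g d e} → f HasDegree≤ d → g HasDegree≤ e → (f ⊛ g) HasDegree≤ (d ℕ.+ e)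
  ⊛-degree {f} {g} {d} {e} f≤d g≤e n d+e<n = sumTo-zero n term≈0
    where
    term≈0 : ∀ k → k ≤ n → f k * g (n ∸ k) ≈ 0#
    term≈0 k _ with d <? k
    ... | yes d<k = trans (*-congʳ (f≤d k d<k)) (zeroˡ _)
    ... | no  d≮k = trans (*-congˡ (g≤e (n ∸ k) e<n∸k)) (zeroʳ _)
      where
      e<n∸k : e < n ∸ k
      e<n∸k = ℕ.m+n≤o⇒m≤o∸n (suc e) (ℕ.≤-trans
        (s≤s (ℕ.≤-trans (ℕ.+-monoʳ-≤ e (ℕ.≮⇒≥ d≮k)) (ℕ.≤-reflexive (ℕ.+-comm e d)))) d+e<n)

  denom-degree : ∀ t φ φ' → denom t φ φ' HasDegree≤ 6
  denom-degree t φ φ' = ⊛-degree (lin-degree _) (⊛-degree (lin-degree _) (⊛-degree (lin-degree _)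
    (⊛-degree (lin-degree _) (⊛-degree (lin-degree _) (lin-degree _)))))

  ⊛-truncate : ∀ {f g d} → f HasDegree≤ d → ∀ m →
               (f ⊛ g) (d ℕ.+ m) ≈ sumTo d (λ k → f k * g (d ℕ.+ m ∸ k))
  ⊛-truncate {d = d} f≤d m = sumTo-extend d (λ k d<k → trans (*-congʳ (f≤d k d<k)) (zeroˡ _)) m

  horadam : C → C → C → C → ℕ → C
  horadam s t a₀ a₁ zero          = a₀
  horadam s t a₀ a₁ (suc zero)    = a₁
  horadam s t a₀ a₁ (suc (suc n)) = s * horadam s t a₀ a₁ (suc n) + t * horadam s t a₀ a₁ n

  Recurrent : C → C → (ℕ → C) → Set ℓ
  Recurrent s t a = ∀ n → a (suc (suc n)) ≈ s * a (suc n) + t * a n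

  Recurrent-shift : ∀ {s t a} → Recurrent s t a → ∀ m → Recurrent s t (λ n → a (n ℕ.+ m))
  Recurrent-shift rec m n = rec (n ℕ.+ m)

  fib-recurrent : ∀ s t → Recurrent s t (fib s t)
  fib-recurrent s t n = refl

  recurrent⇒horadam : ∀ {s t a} → Recurrent s t a → ∀ n → a n ≈ horadam s t (a 0) (a 1) n
  recurrent⇒horadam rec zero          = refl
  recurrent⇒horadam rec (suc zero)    = refl
  recurrent⇒horadam rec (suc (suc n)) =
    trans (rec n) (+-cong (*-congˡ (recurrent⇒horadam rec (suc n))) (*-congˡ (recurrent⇒horadam rec n)))

module GeneratingFunction {c ℓ : Level} (R : CommutativeRing c ℓ) where
  open CommutativeRing R renaming (Carrier to C)
  open Gen R
  open GenProperties R
  open IntegerCoefficients R using (var; ⟦_⟧; ⟦_⟧↓; prove; polynomialRing)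
  open import Relation.Binary.Reasoning.Setoid setoid

  module _ (φ φ' : C) where
    private
      s t : C
      s = φ + φ'
      t = - (φ * φ')

    squared-products-annihilated : ∀ {a b} → Recurrent s t a → Recurrent s t b → ∀ κ →
      sumTo 6 (λ k → denom t φ φ' k * pow (a (6 ∸ k) * b (6 ∸ k) * κ) 2) ≈ 0#
    squared-products-annihilated {a} {b} ra rb κ = begin
      sumTo 6 (λ k → denom t φ φ' k * pow (a (6 ∸ k) * b (6 ∸ k) * κ) 2)
        ≈⟨ sumTo-cong 6 (λ k → *-congˡ {denom t φ φ' k} (pow-cong (*-congʳ {κ}
             (*-cong (recurrent⇒horadam ra (6 ∸ k)) (recurrent⇒horadam rb (6 ∸ k)))) 2)) ⟩
      sumTo 6 (λ k → denom t φ φ' k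
                     * pow (horadam s t (a 0) (a 1) (6 ∸ k) * horadam s t (b 0) (b 1) (6 ∸ k) * κ) 2)
        ≈⟨ prove (φ ∷ φ' ∷ a 0 ∷ a 1 ∷ b 0 ∷ b 1 ∷ κ ∷ []) sumP P.0# refl ⟩
      0# ∎
      where
      module P = CommutativeRing (polynomialRing 7)
      open Gen (polynomialRing 7) using () renaming (sumTo to sumToP; denom to denomP; pow to powP)
      open GenProperties (polynomialRing 7) using () renaming (horadam to horadamP)
      sumP : P.Carrier
      sumP = sumToP 6 (λ k → denomP t̂ φ̂ φ̂' k
                     P.* powP (horadamP ŝ t̂ â₀ â₁ (6 ∸ k) P.* horadamP ŝ t̂ b̂₀ b̂₁ (6 ∸ k) P.* κ̂) 2)
        where
        φ̂ φ̂' â₀ â₁ b̂₀ b̂₁ κ̂ ŝ t̂ : P.Carrier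
        φ̂ = var (# 0); φ̂' = var (# 1); â₀ = var (# 2); â₁ = var (# 3)
        b̂₀ = var (# 4); b̂₁ = var (# 5); κ̂ = var (# 6)
        ŝ = φ̂ P.+ φ̂'; t̂ = P.- (φ̂ P.* φ̂')

    denom⊛squared-products≈0 : ∀ {a b} → Recurrent s t a → Recurrent s t b → ∀ κ m →
      (denom t φ φ' ⊛ (λ n → pow (a n * b n * κ) 2)) (6 ℕ.+ m) ≈ 0#
    denom⊛squared-products≈0 {a} {b} ra rb κ m = begin
      (denom t φ φ' ⊛ (λ n → pow (a n * b n * κ) 2)) (6 ℕ.+ m)
        ≈⟨ ⊛-truncate {g = λ n → pow (a n * b n * κ) 2} (denom-degree t φ φ') m ⟩
      sumTo 6 (λ k → denom t φ φ' k * pow (a (6 ℕ.+ m ∸ k) * b (6 ℕ.+ m ∸ k) * κ) 2)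
        ≡⟨⟩ -- 6 + m ∸ k reduces to (6 ∸ k) + m for each numeral k that sumTo 6 unfolds to
      sumTo 6 (λ k → denom t φ φ' k * pow (a ((6 ∸ k) ℕ.+ m) * b ((6 ∸ k) ℕ.+ m) * κ) 2)
        ≈⟨ squared-products-annihilated (Recurrent-shift ra m) (Recurrent-shift rb m) κ ⟩
      0# ∎

    module _ (sinv : C) (s*sinv≈1 : s * sinv ≈ 1#) where
      private
        module P = CommutativeRing (polynomialRing 3)
        module PG = Gen (polynomialRing 3)

        φ̂ φ̂' ŝinv ŝ t̂ : P.Carrier
        φ̂ = var (# 0); φ̂' = var (# 1); ŝinv = var (# 2)
        ŝ = φ̂ P.+ φ̂'; t̂ = P.- (φ̂ P.* φ̂')

        ρ : Vec C 3
        ρ = φ ∷ φ' ∷ sinv ∷ []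

        productP : ℕ → P.Carrier
        productP = PG.denom t̂ φ̂ φ̂' PG.⊛ PG.triSq ŝ t̂ ŝinv

        -- tri carries the factor sinv², so as polynomials the low coefficients
        -- equal numer only up to the factor (s · sinv)².
        scaledNumerP : ℕ → P.Carrier
        scaledNumerP n = PG.pow (ŝ P.* ŝinv) 2 P.* PG.numer ŝ t̂ φ̂ φ̂' n

        low-coefficient : ∀ n → ⟦ productP n ⟧↓ ρ ≈ ⟦ scaledNumerP n ⟧↓ ρ →
                     ⟦ productP n ⟧ ρ ≈ ⟦ PG.numer ŝ t̂ φ̂ φ̂' n ⟧ ρ
        low-coefficient n same-normal-form = begin
          ⟦ productP n ⟧ ρ
            ≈⟨ prove ρ (productP n) (scaledNumerP n) same-normal-form ⟩
          pow (s * sinv) 2 * ⟦ PG.numer ŝ t̂ φ̂ φ̂' n ⟧ ρ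
            ≈⟨ *-congʳ (trans (pow-cong s*sinv≈1 2) (trans (*-identityˡ _) (*-identityˡ 1#))) ⟩
          1# * ⟦ PG.numer ŝ t̂ φ̂ φ̂' n ⟧ ρ
            ≈⟨ *-identityˡ _ ⟩
          ⟦ PG.numer ŝ t̂ φ̂ φ̂' n ⟧ ρ ∎

      denom⊛triSq≈numer : ∀ n → (denom t φ φ' ⊛ triSq s t sinv) n ≈ numer s t φ φ' n
      denom⊛triSq≈numer 0 = low-coefficient 0 refl
      denom⊛triSq≈numer 1 = low-coefficient 1 refl
      denom⊛triSq≈numer 2 = low-coefficient 2 refl
      denom⊛triSq≈numer 3 = low-coefficient 3 refl
      denom⊛triSq≈numer 4 = low-coefficient 4 refl
      denom⊛triSq≈numer 5 = low-coefficient 5 refl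
      denom⊛triSq≈numer (suc (suc (suc (suc (suc (suc m)))))) = begin
        (denom t φ φ' ⊛ triSq s t sinv) (6 ℕ.+ m)
          ≈⟨ ⊛-cong {denom t φ φ'} (λ _ → refl) (triSq≈tri² s t sinv) (6 ℕ.+ m) ⟩
        (denom t φ φ' ⊛ (λ n → pow (tri s t sinv n) 2)) (6 ℕ.+ m)
          ≈⟨ denom⊛squared-products≈0 (fib-recurrent s t) (λ n → fib-recurrent s t (suc n)) sinv m ⟩
        0# ∎

theorem8 : ∀ {c ℓ : Level} (R : CommutativeRing c ℓ) →
    let open CommutativeRing R renaming (Carrier to C)
        open Gen R
    in (s t sinv φ φ' : C) →
       s * sinv ≈ 1# →
       ¬ (t ≈ 0#) →
       φ + φ' ≈ s →
       φ * φ' ≈ - t →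
       ∀ (n : ℕ) → (denom t φ φ' ⊛ triSq s t sinv) n ≈ numer s t φ φ' n
theorem8 R s t sinv φ φ' s*sinv≈1 _ φ+φ'≈s φφ'≈-t n = begin
  (denom t φ φ' ⊛ triSq s t sinv) n      ≈⟨ ⊛-cong (denom-cong φ φ' t≈) (triSq-cong sinv s≈ t≈) n ⟩
  (denom t' φ φ' ⊛ triSq s' t' sinv) n   ≈⟨ denom⊛triSq≈numer φ φ' sinv (trans (*-congʳ φ+φ'≈s) s*sinv≈1) n ⟩
  numer s' t' φ φ' n                     ≈⟨ numer-cong φ φ' s≈ t≈ n ⟨
  numer s t φ φ' n                       ∎
  where
  open CommutativeRing R
  open Gen R
  open GenProperties R
  open GeneratingFunction R
  open import Algebra.Properties.Ring ring using (-‿involutive)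
  open import Relation.Binary.Reasoning.Setoid setoid
  s' t' : Carrier
  s' = φ + φ'
  t' = - (φ * φ')
  s≈ : s ≈ s'
  s≈ = sym φ+φ'≈s
  t≈ : t ≈ t'
  t≈ = sym (trans (-‿cong φφ'≈-t) (-‿involutive t))
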